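{- Let $m,l,h$ be integers with $0\le h<m$, $0<l$, $6\mid m$, and let $a\in\{ -1,1\}$ with $3\mid(l-ah)$. Suppose $\sigma(h)\sigma(l)\neq0$ or $\sigma(m)>\sigma(l-ah)$. Let $b=\gcd(l-ah,m)$. Then for every choice of $t_0,t_1,\dots,t_{b/3-1}\in\{0,1\}$, the set $\bigcup_{r=0}^{b/3-1}C^{a}(r,t_r)$ is a perfect code of $\Gamma_{m,l,h}\times K_2$, where $C^{a}(r,t_r)=\{(\psi(3r+aj,\,j),\ j+t_r \bmod 2)\in\mathbb{Z}_m\times\mathbb{Z}_l\times\mathbb{Z}_2 : j\in\mathbb{Z}\}$.
   Context: $\hat{x}$ is the least nonnegative integer representative of a residue class $x$. $\Gamma_{m,l,h}$ is the graph with vertex set $\mathbb{Z}_m\times\mathbb{Z}_l$ whose edges are $\{(a,b),(a+1,b)\}$ for all $a,b$; $\{(a,c),(a,c+1)\}$ for all $a$ and all $c\in\mathbb{Z}_l$ with $\hat c\neq l-1$; and $\{(a,-1),(a-h,0)\}$ for all $a\in\mathbb{Z}_m$. For integers $i,J$ define $\psi(i,J)=(i-\lfloor J/l\rfloor h \bmod m,\ J\bmod l)\in\mathbb{Z}_m\times\mathbb{Z}_l$. $K_2$ is the complete graph on $\mathbb{Z}_2$. The Cartesian product $\Gamma\times\Sigma$ has vertex set $V\Gamma\times V\Sigma$, with $(u_1,u_2)\sim(v_1,v_2)$ iff ($u_1\sim v_1$ and $u_2=v_2$) or ($u_1=v_1$ and $u_2\sim v_2$). A perfect code is a vertex set $C$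 such that every vertex is at distance at most $1$ from exactly one vertex of $C$. For an integer $n$, $\sigma(n)$ is the largest nonnegative integer $i$ with $2^i\mid n$ ($\sigma(0)=+\infty$). -}

module Defs where

open import Data.Nat as ℕ using (ℕ; zero; suc; NonZero)
open import Data.Nat.DivMod as ℕD using ()
open import Data.Integer as ℤ using (ℤ; +_; ∣_∣; _+_; _-_; _*_; _/ℕ_; _%ℕ_)
open import Data.Integer.DivMod using (n%ℕd<d)
open import Data.Fin using (Fin; fromℕ<; toℕ)
open import Data.Product using (_×_; _,_; Σ; ∃)
open import Data.Sum using (_⊎_)
open import Relation.Binary.PropositionalEquality using (_≡_; _≢_)
open import Relation.Nullary using (¬_)

[_]_ : ℤ → (n : ℕ) → .{{NonZero n}} → Fin n
[ x ] n = fromℕ< (n%ℕd<d x n)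

data ℕ∞ : Set where
  fin : ℕ → ℕ∞
  ∞   : ℕ∞

data _<∞_ : ℕ∞ → ℕ∞ → Set where
  fin<fin : ∀ {i j} → i ℕ.< j → fin i <∞ fin j
  fin<∞   : ∀ {i} → fin i <∞ ∞

-- v₂ with fuel: number of times 2 divides n (fuel ≥ n suffices for n > 0)
v₂ : ℕ → ℕ → ℕ
v₂ zero    n = 0
v₂ (suc f) zero = 0
v₂ (suc f) (suc n) with (suc n) ℕ.% 2
... | zero  = suc (v₂ f ((suc n) ℕ./ 2))
... | suc _ = 0

σ : ℤ → ℕ∞
σ x with ∣ x ∣
... | zero  = ∞
... | suc k = fin (v₂ (suc k) (suc k))

record Graph : Set₁ where
  field
    V   : Set
    _~_ : V → V → Set

open Graph public

_□_ : Graph → Graph → Graph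
V   (Γ □ Δ) = V Γ × V Δ
_~_ (Γ □ Δ) (u₁ , u₂) (v₁ , v₂) =
  (_~_ Γ u₁ v₁ × u₂ ≡ v₂) ⊎ (u₁ ≡ v₁ × _~_ Δ u₂ v₂)

K₂ : Graph
V   K₂ = Fin 2
_~_ K₂ u v = u ≢ v

dist≤1 : (Γ : Graph) → V Γ → V Γ → Set
dist≤1 Γ u v = u ≡ v ⊎ _~_ Γ u v

IsPerfectCode : (Γ : Graph) → (V Γ → Set) → Set
IsPerfectCode Γ C =
  (v : V Γ) →
    (Σ (V Γ) λ c → C c × dist≤1 Γ v c)
    × (∀ c c' → C c → C c' → dist≤1 Γ v c → dist≤1 Γ v c' → c ≡ c')

module _ (m l h : ℕ) .{{_ : NonZero m}} .{{_ : NonZero l}} where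

  data ΓEdge : Fin m × Fin l → Fin m × Fin l → Set where
    edge-a : (a b : ℤ) →
      ΓEdge ([ a ] m , [ b ] l) ([ a + + 1 ] m , [ b ] l)
    edge-c : (a c : ℤ) → toℕ ([ c ] l) ≢ ℕ._∸_ l 1 →
      ΓEdge ([ a ] m , [ c ] l) ([ a ] m , [ c + + 1 ] l)
    edge-h : (a : ℤ) →
      ΓEdge ([ a ] m , [ ℤ.- + 1 ] l) ([ a - + h ] m , [ + 0 ] l)

  ΓG : Graph
  V   ΓG = Fin m × Fin l
  _~_ ΓG u v = ΓEdge u v ⊎ ΓEdge v u

  ψ : ℤ → ℤ → Fin m × Fin l
  ψ i J = [ i - (J /ℕ l) * + h ] m , [ J ] l

module _ (m l h : ℕ) .{{_ : NonZero m}} .{{_ : NonZero l}} where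
  Cᵃ : (a : ℤ) (r : ℕ) (tᵣ : Fin 2) → V (ΓG m l h □ K₂) → Set
  Cᵃ a r tᵣ (v , s) = ∃ λ (j : ℤ) →
    (v ≡ ψ m l h (+ 3 * + r + a * j) j) × (s ≡ [ j + + toℕ tᵣ ] 2)

{-# OPTIONS --safe #-}

-- The map π i J = ψ(i, J) makes the grid ℤ² a covering of Γ_{m,l,h}: it identifies points
-- differing by the lattice L = ℤ(m, 0) + ℤ(h, l), and the neighbours of π p are the images of
-- the four grid neighbours of p.  The level i − aJ changes by ±1 along every grid step and,
-- since the generators of L have levels m and −a·g with g = l − ah, it is invariant modulo
-- b = gcd(g, m) = 3B.  The code C^a(r, t_r) is the image of the line i − aJ = 3r, which by
-- Bézout meets every vertex of level ≡ 3r (mod b).  A vertex of level ≡ 0 (mod 3) is dominated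
-- through its K₂-copy; a vertex of level ≡ ±1 has two grid neighbours that are one step apart
-- on the same code line, hence carry different colours, and exactly one of them matches.  For
-- uniqueness, levels modulo 3 separate all other pairs of closed neighbours, levels modulo b
-- identify the line, and the 2-adic hypothesis makes every period of a code line even, so that
-- colours are well defined.

module Submission where

open import Data.Empty using (⊥-elim)
open import Data.Fin as Fin using (Fin; toℕ)
import Data.Fin.Properties as Finₚ
open import Data.Integer as ℤ
  using (ℤ; +_; -[1+_]; ∣_∣; _+_; _-_; _*_; -_; _/ℕ_; _%ℕ_; 0ℤ; 1ℤ; -1ℤ)
open import Data.Integer.DivMod using (n%ℕd<d; a≡a%ℕn+[a/ℕn]*n)
open import Data.Integer.Divisibility as ℤ∣ using ()
open import Data.Integer.Divisibility.Signed
  using (_∣_; divides; ∣ᵤ⇒∣; ∣⇒∣ᵤ; ∣-refl; ∣-trans; ∣m⇒∣-m; ∣m∣n⇒∣m+n; ∣m∣n⇒∣m-n;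
         ∣n⇒∣m*n; ∣m⇒∣m*n; *-monoʳ-∣; *-cancelˡ-∣)
import Data.Integer.Properties as ℤₚ
open import Data.Integer.Tactic.RingSolver using (solve-∀)
open import Data.Nat as ℕ using (ℕ; zero; suc; NonZero; _<_; _/_)
import Data.Nat.DivMod as ℕDM
open import Data.Nat.Divisibility as ℕ∣ using () renaming (_∣_ to _∣ℕ_)
open import Data.Nat.GCD using (gcd; gcd[m,n]∣m; gcd[m,n]∣n; gcd-greatest; gcd[m,n]≢0; gcd-GCD; module Bézout)
open import Data.Nat.Primality using (euclidsLemma; prime[2])
import Data.Nat.Properties as ℕₚ
import Data.Nat.Tactic.RingSolver as ℕSolver
open import Data.Product using (_×_; _,_; ∃; ∃₂; ∃-syntax; proj₁; proj₂)
open import Data.Sum using (_⊎_; inj₁; inj₂; [_,_]′; map₁)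
open import Function using (_⟨_⟩_)
open import Relation.Binary.PropositionalEquality
  using (_≡_; _≢_; refl; sym; trans; cong; cong₂; subst; subst₂; module ≡-Reasoning)
open import Relation.Nullary using (¬_; Dec; yes; no)

open import Defs

-- Congruences and residues

-- A record rather than a definition, so that x and y can be inferred from the type.
infix 4 _≡_[mod_]
record _≡_[mod_] (x y n : ℤ) : Set where
  constructor congruent
  field divides-difference : n ∣ x - y

open _≡_[mod_] using (divides-difference)

≡+*⇒≡[mod] : ∀ {x y n} k → x ≡ y + k * n → x ≡ y [mod n ]
≡+*⇒≡[mod] {x} {y} {n} k x≡y+kn = congruent (divides k (trans (cong (_- y) x≡y+kn) (cancel y (k * n))))
  where
  cancel : ∀ y z → (y + z) - y ≡ z
  cancel = solve-∀

≡[mod]⇒≡+* : ∀ {x y n} → x ≡ y [mod n ] → ∃[ k ] x ≡ y + k * n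
≡[mod]⇒≡+* {x} {y} {n} (congruent (divides k x-y≡kn)) = k , trans (move x y) (cong (_+_ y) x-y≡kn)
  where
  move : ∀ x y → x ≡ y + (x - y)
  move = solve-∀

module _ {n : ℤ} where

  ≡⇒≡[mod] : ∀ {x y} → x ≡ y → x ≡ y [mod n ]
  ≡⇒≡[mod] {x} refl = ≡+*⇒≡[mod] 0ℤ (sym (ℤₚ.+-identityʳ x))

  ≡[mod]-sym : ∀ {x y} → x ≡ y [mod n ] → y ≡ x [mod n ]
  ≡[mod]-sym {x} {y} (congruent n∣x-y) = congruent (subst (n ∣_) (negate x y) (∣m⇒∣-m n∣x-y))
    where
    negate : ∀ x y → - (x - y) ≡ y - x
    negate = solve-∀

  ≡[mod]-trans : ∀ {x y z} → x ≡ y [mod n ] → y ≡ z [mod n ] → x ≡ z [mod n ]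
  ≡[mod]-trans {x} {y} {z} (congruent n∣x-y) (congruent n∣y-z) =
    congruent (subst (n ∣_) (telescope x y z) (∣m∣n⇒∣m+n n∣x-y n∣y-z))
    where
    telescope : ∀ x y z → (x - y) + (y - z) ≡ x - z
    telescope = solve-∀

  ≡[mod]-weaken : ∀ {n' x y} → n' ∣ n → x ≡ y [mod n ] → x ≡ y [mod n' ]
  ≡[mod]-weaken n'∣n (congruent n∣x-y) = congruent (∣-trans n'∣n n∣x-y)

  ≡[mod]-scale : ∀ k {x y} → x ≡ y [mod n ] → k * x ≡ k * y [mod k * n ]
  ≡[mod]-scale k {x} {y} (congruent n∣x-y) =
    congruent (subst (k * n ∣_) (distrib k x y) (*-monoʳ-∣ k n∣x-y))
    where
    distrib : ∀ k x y → k * (x - y) ≡ k * x - k * y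
    distrib = solve-∀

  ≡[mod]-+ʳ : ∀ {x y} z → x ≡ y [mod n ] → x + z ≡ y + z [mod n ]
  ≡[mod]-+ʳ {x} {y} z (congruent n∣x-y) = congruent (subst (n ∣_) (shift x y z) n∣x-y)
    where
    shift : ∀ x y z → x - y ≡ (x + z) - (y + z)
    shift = solve-∀

  ≡[mod]-+-cancelˡ : ∀ {x y} z → z + x ≡ z + y [mod n ] → x ≡ y [mod n ]
  ≡[mod]-+-cancelˡ {x} {y} z (congruent n∣z+x-[z+y]) = congruent (subst (n ∣_) (cancel x y z) n∣z+x-[z+y])
    where
    cancel : ∀ x y z → (z + x) - (z + y) ≡ x - y
    cancel = solve-∀

  ≡[mod]-cancel : ∀ k .{{_ : ℤ.NonZero k}} {x y} → k * x ≡ k * y [mod k * n ] → x ≡ y [mod n ]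
  ≡[mod]-cancel k {x} {y} (congruent kn∣kx-ky) =
    congruent (*-cancelˡ-∣ k (subst (k * n ∣_) (factor k x y) kn∣kx-ky))
    where
    factor : ∀ k x y → k * x - k * y ≡ k * (x - y)
    factor = solve-∀

module _ {n : ℕ} .{{_ : NonZero n}} where

  private
    n≤r+[1+k]n : ∀ r k → n ℕ.≤ r ℕ.+ suc k ℕ.* n
    n≤r+[1+k]n r k = ℕₚ.≤-trans (ℕₚ.m≤n*m n (suc k)) (ℕₚ.m≤n+m _ r)

    pos-+-*-injective : ∀ r k r' → + r + + k * + n ≡ + r' → r ℕ.+ k ℕ.* n ≡ r'
    pos-+-*-injective r k r' eq = ℤₚ.+-injective (begin
      + (r ℕ.+ k ℕ.* n)  ≡⟨ ℤₚ.pos-+ r (k ℕ.* n) ⟩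
      + r + + (k ℕ.* n)  ≡⟨ cong (_+_ (+ r)) (ℤₚ.pos-* k n) ⟩
      + r + + k * + n    ≡⟨ eq ⟩
      + r'               ∎)
      where open ≡-Reasoning

    quotient-unique : ∀ {r r'} d → r ℕ.< n → r' ℕ.< n → + r + d * + n ≡ + r' → d ≡ 0ℤ
    quotient-unique (+ zero) _ _ _ = refl
    quotient-unique {r} {r'} (+ suc k) _ r'<n r+dn≡r' =
      ⊥-elim (ℕₚ.<⇒≱ r'<n (subst (n ℕ.≤_) (pos-+-*-injective r (suc k) r' r+dn≡r') (n≤r+[1+k]n r k)))
    quotient-unique {r} {r'} -[1+ k ] r<n _ r+dn≡r' =
      ⊥-elim (ℕₚ.<⇒≱ r<n (subst (n ℕ.≤_) (pos-+-*-injective r' (suc k) r r'+[1+k]n≡r) (n≤r+[1+k]n r' k)))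
      where
      cancel : ∀ r K n → (r + - K * n) + K * n ≡ r
      cancel = solve-∀
      r'+[1+k]n≡r : + r' + + suc k * + n ≡ + r
      r'+[1+k]n≡r = trans (cong (_+ + suc k * + n) (sym r+dn≡r')) (cancel (+ r) (+ suc k) (+ n))

  divMod-unique : ∀ x r q → r ℕ.< n → x ≡ + r + q * + n → x %ℕ n ≡ r × x /ℕ n ≡ q
  divMod-unique x r q r<n x≡r+qn = r≡ , sym q≡
    where
    step : + r + (q - x /ℕ n) * + n ≡ + (x %ℕ n)
    step = begin
      + r + (q - x /ℕ n) * + n                      ≡⟨ regroup (+ r) q (x /ℕ n) (+ n) ⟩
      (+ r + q * + n) - x /ℕ n * + n                 ≡⟨ cong (_- x /ℕ n * + n) (sym x≡r+qn) ⟩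
      x - x /ℕ n * + n                               ≡⟨ cong (_- x /ℕ n * + n) (a≡a%ℕn+[a/ℕn]*n x n) ⟩
      (+ (x %ℕ n) + x /ℕ n * + n) - x /ℕ n * + n     ≡⟨ cancel (+ (x %ℕ n)) (x /ℕ n * + n) ⟩
      + (x %ℕ n)                                     ∎
      where
      open ≡-Reasoning
      regroup : ∀ r q q' n → r + (q - q') * n ≡ (r + q * n) - q' * n
      regroup = solve-∀
      cancel : ∀ r s → (r + s) - s ≡ r
      cancel = solve-∀
    d≡0 : q - x /ℕ n ≡ 0ℤ
    d≡0 = quotient-unique (q - x /ℕ n) r<n (n%ℕd<d x n) step
    q≡ : q ≡ x /ℕ n
    q≡ = ℤₚ.i-j≡0⇒i≡j q (x /ℕ n) d≡0
    r≡ : x %ℕ n ≡ r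
    r≡ = sym (ℤₚ.+-injective (begin
      + r                 ≡⟨ sym (ℤₚ.+-identityʳ (+ r)) ⟩
      + r + 0ℤ * + n      ≡⟨ cong (λ d → + r + d * + n) (sym d≡0) ⟩
      + r + (q - x /ℕ n) * + n ≡⟨ step ⟩
      + (x %ℕ n)          ∎))
      where open ≡-Reasoning

  divMod-shift : ∀ x y k → x ≡ y + k * + n → x %ℕ n ≡ y %ℕ n × x /ℕ n ≡ y /ℕ n + k
  divMod-shift x y k x≡y+kn = divMod-unique x (y %ℕ n) (y /ℕ n + k) (n%ℕd<d y n) (begin
    x                                     ≡⟨ x≡y+kn ⟩
    y + k * + n                           ≡⟨ cong (_+ k * + n) (a≡a%ℕn+[a/ℕn]*n y n) ⟩
    (+ (y %ℕ n) + y /ℕ n * + n) + k * + n ≡⟨ regroup (+ (y %ℕ n)) (y /ℕ n) k (+ n) ⟩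
    + (y %ℕ n) + (y /ℕ n + k) * + n       ∎)
    where
    open ≡-Reasoning
    regroup : ∀ r q k n → (r + q * n) + k * n ≡ r + (q + k) * n
    regroup = solve-∀


  toℕ[]≡%ℕ : ∀ x → toℕ ([ x ] n) ≡ x %ℕ n
  toℕ[]≡%ℕ x = Finₚ.toℕ-fromℕ< (n%ℕd<d x n)

  []-cong : ∀ x y → x ≡ y [mod + n ] → [ x ] n ≡ [ y ] n
  []-cong x y x≡y with ≡[mod]⇒≡+* x≡y
  ... | k , x≡y+kn = Finₚ.fromℕ<-cong _ _ (proj₁ (divMod-shift x y k x≡y+kn)) _ _

  []-injective : ∀ x y → [ x ] n ≡ [ y ] n → x ≡ y [mod + n ]
  []-injective x y [x]≡[y] = ≡+*⇒≡[mod] (q - q') (begin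
    x                                  ≡⟨ a≡a%ℕn+[a/ℕn]*n x n ⟩
    + (x %ℕ n) + q * + n               ≡⟨ cong (λ r → + r + q * + n) x%n≡y%n ⟩
    + (y %ℕ n) + q * + n               ≡⟨ regroup (+ (y %ℕ n)) q q' (+ n) ⟩
    (+ (y %ℕ n) + q' * + n) + (q - q') * + n ≡⟨ cong (_+ (q - q') * + n) (sym (a≡a%ℕn+[a/ℕn]*n y n)) ⟩
    y + (q - q') * + n                 ∎)
    where
    open ≡-Reasoning
    q = x /ℕ n
    q' = y /ℕ n
    regroup : ∀ r q q' n → r + q * n ≡ (r + q' * n) + (q - q') * n
    regroup = solve-∀
    x%n≡y%n : x %ℕ n ≡ y %ℕ n
    x%n≡y%n = trans (sym (toℕ[]≡%ℕ x)) (trans (cong toℕ [x]≡[y]) (toℕ[]≡%ℕ y))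

  ≡toℕ[] : ∀ x → x ≡ + toℕ ([ x ] n) [mod + n ]
  ≡toℕ[] x = ≡+*⇒≡[mod] (x /ℕ n) (trans (a≡a%ℕn+[a/ℕn]*n x n)
               (cong (λ r → + r + x /ℕ n * + n) (sym (toℕ[]≡%ℕ x))))

  []-toℕ : ∀ (X : Fin n) → [ + toℕ X ] n ≡ X
  []-toℕ X = trans (Finₚ.fromℕ<-cong _ _ (ℕDM.m<n⇒m%n≡m (Finₚ.toℕ<n X)) _ (Finₚ.toℕ<n X))
                   (Finₚ.fromℕ<-toℕ X (Finₚ.toℕ<n X))

  toℕ-/ℕ : ∀ (X : Fin n) → + toℕ X /ℕ n ≡ 0ℤ
  toℕ-/ℕ X = cong +_ (ℕDM.m<n⇒m/n≡0 (Finₚ.toℕ<n X))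

/ℕ-suc : ∀ n .{{_ : NonZero n}} J → J %ℕ n ≢ n ℕ.∸ 1 → (J + 1ℤ) /ℕ n ≡ J /ℕ n
/ℕ-suc (suc n) J J%n≢n = proj₂ (divMod-unique (J + 1ℤ) (suc (J %ℕ suc n)) (J /ℕ suc n)
  (ℕ.s≤s (ℕₚ.≤∧≢⇒< (ℕₚ.≤-pred (n%ℕd<d J (suc n))) J%n≢n))
  (trans (cong (_+ 1ℤ) (a≡a%ℕn+[a/ℕn]*n J (suc n))) (regroup (+ (J %ℕ suc n)) (J /ℕ suc n) (+ suc n))))
  where
  regroup : ∀ r q n → (r + q * n) + 1ℤ ≡ (1ℤ + r) + q * n
  regroup = solve-∀

J%n≡n∸1⇒J+1≡[J/n+1]*n : ∀ n .{{_ : NonZero n}} J → J %ℕ n ≡ n ℕ.∸ 1 → J + 1ℤ ≡ (J /ℕ n + 1ℤ) * + n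
J%n≡n∸1⇒J+1≡[J/n+1]*n (suc n) J J%n≡n = begin
  J + 1ℤ                                       ≡⟨ cong (_+ 1ℤ) (a≡a%ℕn+[a/ℕn]*n J (suc n)) ⟩
  (+ (J %ℕ suc n) + J /ℕ suc n * + suc n) + 1ℤ ≡⟨ cong (λ r → (+ r + J /ℕ suc n * (1ℤ + + n)) + 1ℤ) J%n≡n ⟩
  (+ n + J /ℕ suc n * (1ℤ + + n)) + 1ℤ         ≡⟨ regroup (+ n) (J /ℕ suc n) ⟩
  (J /ℕ suc n + 1ℤ) * + suc n                  ∎
  where
  open ≡-Reasoning
  regroup : ∀ n q → (n + q * (1ℤ + n)) + 1ℤ ≡ (q + 1ℤ) * (1ℤ + n)
  regroup = solve-∀

-1/ℕ : ∀ n .{{_ : NonZero n}} → -1ℤ /ℕ n ≡ -1ℤ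
-1/ℕ (suc n) = proj₂ (divMod-unique -1ℤ n -1ℤ (ℕₚ.n<1+n n) (regroup (+ n)))
  where
  regroup : ∀ n → -1ℤ ≡ n + -1ℤ * (1ℤ + n)
  regroup = solve-∀

0/ℕ : ∀ n .{{_ : NonZero n}} → 0ℤ /ℕ n ≡ 0ℤ
0/ℕ (suc n) = refl

abs-as-multiple : ∀ x → ∃[ s ] + ∣ x ∣ ≡ s * x
abs-as-multiple x with ℤₚ.+∣i∣≡i⊎+∣i∣≡-i x
... | inj₁ ∣x∣≡x  = 1ℤ , trans ∣x∣≡x (sym (ℤₚ.*-identityˡ x))
... | inj₂ ∣x∣≡-x = -1ℤ , trans ∣x∣≡-x (sym (ℤₚ.-1*i≡-i x))

gcd-bézout : ∀ (x : ℤ) n → ∃₂ λ U W → + gcd ∣ x ∣ n ≡ U * + n + W * x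
gcd-bézout x n with abs-as-multiple x | Bézout.identity (gcd-GCD ∣ x ∣ n)
... | s , ∣x∣≡sx | Bézout.+- X Y d+Yn≡X∣x∣ = - + Y , + X * s , (begin
  + d                            ≡⟨ isolate (+ d) (+ Y * + n) ⟩
  (+ d + + Y * + n) - + Y * + n  ≡⟨ cong (_- + Y * + n) (cast d+Yn≡X∣x∣) ⟩
  + X * + ∣ x ∣ - + Y * + n      ≡⟨ cong (λ z → + X * z - + Y * + n) ∣x∣≡sx ⟩
  + X * (s * x) - + Y * + n      ≡⟨ regroup (+ X) (+ Y) s x (+ n) ⟩
  - + Y * + n + + X * s * x      ∎)
  where
  open ≡-Reasoning
  d = gcd ∣ x ∣ n
  cast : d ℕ.+ Y ℕ.* n ≡ X ℕ.* ∣ x ∣ → + d + + Y * + n ≡ + X * + ∣ x ∣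
  cast eq = trans (cong (λ z → + d + z) (sym (ℤₚ.pos-* Y n))) (trans (cong +_ eq) (ℤₚ.pos-* X ∣ x ∣))
  isolate : ∀ d z → d ≡ (d + z) - z
  isolate = solve-∀
  regroup : ∀ X Y s x n → X * (s * x) - Y * n ≡ - Y * n + X * s * x
  regroup = solve-∀
... | s , ∣x∣≡sx | Bézout.-+ X Y d+X∣x∣≡Yn = + Y , - (+ X * s) , (begin
  + d                                ≡⟨ isolate (+ d) (+ X * + ∣ x ∣) ⟩
  (+ d + + X * + ∣ x ∣) - + X * + ∣ x ∣ ≡⟨ cong (_- + X * + ∣ x ∣) (cast d+X∣x∣≡Yn) ⟩
  + Y * + n - + X * + ∣ x ∣          ≡⟨ cong (λ z → + Y * + n - + X * z) ∣x∣≡sx ⟩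
  + Y * + n - + X * (s * x)          ≡⟨ regroup (+ X) (+ Y) s x (+ n) ⟩
  + Y * + n + - (+ X * s) * x        ∎)
  where
  open ≡-Reasoning
  d = gcd ∣ x ∣ n
  cast : d ℕ.+ X ℕ.* ∣ x ∣ ≡ Y ℕ.* n → + d + + X * + ∣ x ∣ ≡ + Y * + n
  cast eq = trans (cong (λ z → + d + z) (sym (ℤₚ.pos-* X ∣ x ∣))) (trans (cong +_ eq) (ℤₚ.pos-* Y n))
  isolate : ∀ d z → d ≡ (d + z) - z
  isolate = solve-∀
  regroup : ∀ X Y s x n → Y * n - X * (s * x) ≡ Y * n + - (X * s) * x
  regroup = solve-∀

IsUnit : ℤ → Set
IsUnit e = e ≡ 1ℤ ⊎ e ≡ -1ℤ

unit-square : ∀ {a} → IsUnit a → a * a ≡ 1ℤ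
unit-square (inj₁ refl) = refl
unit-square (inj₂ refl) = refl

-‿unit : ∀ {e} → IsUnit e → IsUnit (- e)
-‿unit (inj₁ refl) = inj₂ refl
-‿unit (inj₂ refl) = inj₁ refl

*-unit : ∀ {a e} → IsUnit a → IsUnit e → IsUnit (a * e)
*-unit (inj₁ refl) (inj₁ refl) = inj₁ refl
*-unit (inj₁ refl) (inj₂ refl) = inj₂ refl
*-unit (inj₂ refl) (inj₁ refl) = inj₂ refl
*-unit (inj₂ refl) (inj₂ refl) = inj₁ refl

unit≢0[mod3] : ∀ {e} → IsUnit e → ¬ e ≡ 0ℤ [mod + 3 ]
unit≢0[mod3] (inj₁ refl) 1≡0 with []-cong 1ℤ 0ℤ 1≡0
... | ()
unit≢0[mod3] (inj₂ refl) -1≡0 with []-cong -1ℤ 0ℤ -1≡0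
... | ()

units-≡[mod3] : ∀ {e e'} → IsUnit e → IsUnit e' → e ≡ e' [mod + 3 ] → e ≡ e'
units-≡[mod3] (inj₁ refl) (inj₁ refl) _ = refl
units-≡[mod3] (inj₂ refl) (inj₂ refl) _ = refl
units-≡[mod3] (inj₁ refl) (inj₂ refl) 1≡-1 with []-cong 1ℤ -1ℤ 1≡-1
... | ()
units-≡[mod3] (inj₂ refl) (inj₁ refl) -1≡1 with []-cong -1ℤ 1ℤ -1≡1
... | ()

mod3-cases : ∀ z → z ≡ 0ℤ [mod + 3 ] ⊎ ∃[ ε ] IsUnit ε × z ≡ ε [mod + 3 ]
mod3-cases z with [ z ] 3 | ≡toℕ[] {3} z
... | Fin.zero                   | z≡0 = inj₁ z≡0
... | Fin.suc Fin.zero           | z≡1 = inj₂ (1ℤ , inj₁ refl , z≡1)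
... | Fin.suc (Fin.suc Fin.zero) | z≡2 = inj₂ (-1ℤ , inj₂ refl , ≡[mod]-trans z≡2 (≡+*⇒≡[mod] 1ℤ refl))

[x]₂≢[x+k]₂ : ∀ {k} → IsUnit k → ∀ x → [ x ] 2 ≢ [ x + k ] 2
[x]₂≢[x+k]₂ {k} k-unit x [x]≡[x+k] = [k]≢[0] k-unit ([]-cong k 0ℤ k≡0)
  where
  shift : ∀ x k → (x + k) - x ≡ k - 0ℤ
  shift = solve-∀
  k≡0 : k ≡ 0ℤ [mod + 2 ]
  k≡0 = congruent (subst (+ 2 ∣_) (shift x k) (divides-difference ([]-injective (x + k) x (sym [x]≡[x+k]))))
  [k]≢[0] : IsUnit k → [ k ] 2 ≢ [ 0ℤ ] 2
  [k]≢[0] (inj₁ refl) ()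
  [k]≢[0] (inj₂ refl) ()

Fin2-dichotomy : ∀ {x y : Fin 2} → x ≢ y → ∀ z → x ≡ z ⊎ y ≡ z
Fin2-dichotomy {Fin.zero}          {Fin.zero}          x≢y _ = ⊥-elim (x≢y refl)
Fin2-dichotomy {Fin.suc Fin.zero}  {Fin.suc Fin.zero}  x≢y _ = ⊥-elim (x≢y refl)
Fin2-dichotomy {Fin.zero}          {Fin.suc Fin.zero}  _ Fin.zero           = inj₁ refl
Fin2-dichotomy {Fin.zero}          {Fin.suc Fin.zero}  _ (Fin.suc Fin.zero) = inj₂ refl
Fin2-dichotomy {Fin.suc Fin.zero}  {Fin.zero}          _ Fin.zero           = inj₂ refl
Fin2-dichotomy {Fin.suc Fin.zero}  {Fin.zero}          _ (Fin.suc Fin.zero) = inj₁ refl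

-- The covering of Γ_{m,l,h} by the grid

module Covering (m l h : ℕ) .{{_ : NonZero m}} .{{_ : NonZero l}} where

  π : ℤ → ℤ → Fin m × Fin l
  π = ψ m l h

  π-≡⁺ : ∀ i J i' J' v → J ≡ J' + v * + l → i ≡ i' + v * + h [mod + m ] → π i J ≡ π i' J'
  π-≡⁺ i J i' J' v J≡J'+vl i≡i'+vh = cong₂ _,_ ([]-cong _ _ first) ([]-cong J J' (≡+*⇒≡[mod] v J≡J'+vl))
    where
    first : i - J /ℕ l * + h ≡ i' - J' /ℕ l * + h [mod + m ]
    first = congruent (subst (+ m ∣_) (begin
      i - (i' + v * + h)                              ≡⟨ regroup i i' (J' /ℕ l) v (+ h) ⟩
      (i - (J' /ℕ l + v) * + h) - (i' - J' /ℕ l * + h) ≡⟨ cong (λ q → (i - q * + h) - (i' - J' /ℕ l * + h))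
                                                            (sym (proj₂ (divMod-shift J J' v J≡J'+vl))) ⟩
      (i - J /ℕ l * + h) - (i' - J' /ℕ l * + h)        ∎) (divides-difference i≡i'+vh))
      where
      open ≡-Reasoning
      regroup : ∀ i i' q v h → i - (i' + v * h) ≡ (i - (q + v) * h) - (i' - q * h)
      regroup = solve-∀

  π-≡⁻ : ∀ i J i' J' → π i J ≡ π i' J' → ∃[ v ] J ≡ J' + v * + l × (i ≡ i' + v * + h [mod + m ])
  π-≡⁻ i J i' J' πiJ≡πi'J' with ≡[mod]⇒≡+* ([]-injective J J' (cong proj₂ πiJ≡πi'J'))
  ... | v , J≡J'+vl = v , J≡J'+vl , congruent (subst (+ m ∣_) (begin
      (i - J /ℕ l * + h) - (i' - J' /ℕ l * + h)        ≡⟨ cong (λ q → (i - q * + h) - (i' - J' /ℕ l * + h))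
                                                            (proj₂ (divMod-shift J J' v J≡J'+vl)) ⟩
      (i - (J' /ℕ l + v) * + h) - (i' - J' /ℕ l * + h) ≡⟨ regroup i i' (J' /ℕ l) v (+ h) ⟩
      i - (i' + v * + h)                              ∎) (divides-difference first))
      where
      open ≡-Reasoning
      regroup : ∀ i i' q v h → (i - (q + v) * h) - (i' - q * h) ≡ i - (i' + v * h)
      regroup = solve-∀
      first : i - J /ℕ l * + h ≡ i' - J' /ℕ l * + h [mod + m ]
      first = []-injective (i - J /ℕ l * + h) (i' - J' /ℕ l * + h) (cong proj₁ πiJ≡πi'J')

  π-translate : ∀ i J i' J' x y → π i J ≡ π i' J' → π (i + x) (J + y) ≡ π (i' + x) (J' + y)
  π-translate i J i' J' x y πiJ≡πi'J' with π-≡⁻ i J i' J' πiJ≡πi'J'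
  ... | v , J≡J'+vl , i≡i'+vh =
    π-≡⁺ (i + x) (J + y) (i' + x) (J' + y) v (trans (cong (_+ y) J≡J'+vl) (shift J' v (+ l) y))
           (congruent (subst (+ m ∣_) (translate i i' v (+ h) x) (divides-difference i≡i'+vh)))
    where
    shift : ∀ J v l y → (J + v * l) + y ≡ (J + y) + v * l
    shift = solve-∀
    translate : ∀ i i' v h x → i - (i' + v * h) ≡ (i + x) - ((i' + x) + v * h)
    translate = solve-∀

  π-toℕ : ∀ X Y → π (+ toℕ X) (+ toℕ Y) ≡ (X , Y)
  π-toℕ X Y = cong₂ _,_ (trans (cong (λ q → [ + toℕ X - q * + h ] m) (toℕ-/ℕ Y))
                                (trans (cong (λ x → [ x ] m) (ℤₚ.+-identityʳ (+ toℕ X))) ([]-toℕ X)))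
                        ([]-toℕ Y)

  Γ : Graph
  Γ = ΓG m l h

  vertex-π : ∀ α J → ([ α ] m , [ J ] l) ≡ π (α + J /ℕ l * + h) J
  vertex-π α J = cong (λ x → [ x ] m , [ J ] l) (cancel α (J /ℕ l * + h))
    where
    cancel : ∀ α z → α ≡ (α + z) - z
    cancel = solve-∀

  wrap-source : ∀ α → ([ α ] m , [ -1ℤ ] l) ≡ π (α - + h) -1ℤ
  wrap-source α = trans (vertex-π α -1ℤ) (cong (λ q → π (α + q * + h) -1ℤ) (-1/ℕ l))
                  ⟨ trans ⟩ cong (λ x → π x -1ℤ) (simplify α (+ h))
    where
    simplify : ∀ α h → α + -1ℤ * h ≡ α - h
    simplify = solve-∀

  wrap-target : ∀ α → ([ α - + h ] m , [ 0ℤ ] l) ≡ π (α - + h) 0ℤ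
  wrap-target α = trans (vertex-π (α - + h) 0ℤ) (cong (λ q → π (α - + h + q * + h) 0ℤ) (0/ℕ l))
                  ⟨ trans ⟩ cong (λ x → π x 0ℤ) (simplify (α - + h) (+ h))
    where
    simplify : ∀ α h → α + 0ℤ * h ≡ α
    simplify = solve-∀

  edgeʰ : ∀ i J → ΓEdge m l h (π i J) (π (i + 1ℤ) J)
  edgeʰ i J = subst (λ x → ΓEdge m l h (π i J) ([ x ] m , [ J ] l)) (swap i (J /ℕ l * + h))
                (edge-a (i - J /ℕ l * + h) J)
    where
    swap : ∀ i z → (i - z) + 1ℤ ≡ (i + 1ℤ) - z
    swap = solve-∀

  edgeᵛ : ∀ i J → ΓEdge m l h (π i J) (π i (J + 1ℤ))
  edgeᵛ i J with J %ℕ l ℕ.≟ l ℕ.∸ 1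
  ... | no J%l≢l∸1 = subst (λ q → ΓEdge m l h (π i J) ([ i - q * + h ] m , [ J + 1ℤ ] l))
                          (sym (/ℕ-suc l J J%l≢l∸1))
                          (edge-c (i - J /ℕ l * + h) J (λ eq → J%l≢l∸1 (trans (sym (toℕ[]≡%ℕ J)) eq)))
  ... | yes J%l≡l∸1 = subst₂ (ΓEdge m l h) (sym (trans (lift -1ℤ J≡-1+vl) (sym (wrap-source α))))
                                           (sym (trans (lift 0ℤ J+1≡0+vl) (sym (wrap-target α))))
                                           (edge-h α)
    where
    α = i - J /ℕ l * + h
    v = J /ℕ l + 1ℤ
    J+1≡vl : J + 1ℤ ≡ v * + l
    J+1≡vl = J%n≡n∸1⇒J+1≡[J/n+1]*n l J J%l≡l∸1
    J≡-1+vl : J ≡ -1ℤ + v * + l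
    J≡-1+vl = trans (pred-suc J) (cong (_+_ -1ℤ) J+1≡vl)
      where
      pred-suc : ∀ J → J ≡ -1ℤ + (J + 1ℤ)
      pred-suc = solve-∀
    J+1≡0+vl : J + 1ℤ ≡ 0ℤ + v * + l
    J+1≡0+vl = trans J+1≡vl (sym (ℤₚ.+-identityˡ _))
    lift : ∀ {J'} J₀ → J' ≡ J₀ + v * + l → π i J' ≡ π (α - + h) J₀
    lift {J'} J₀ J'≡J₀+vl =
      π-≡⁺ i J' (α - + h) J₀ v J'≡J₀+vl (≡+*⇒≡[mod] 0ℤ (unwind i (J /ℕ l) (+ h) (+ m)))
      where
      unwind : ∀ i q h m → i ≡ ((i - q * h) - h + (q + 1ℤ) * h) + 0ℤ * m
      unwind = solve-∀

  edge-lift : ∀ {u w} → ΓEdge m l h u w →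
              ∃₂ λ i J → u ≡ π i J × (w ≡ π (i + 1ℤ) J ⊎ w ≡ π i (J + 1ℤ))
  edge-lift (edge-a α β) = α + β /ℕ l * + h , β , vertex-π α β ,
    inj₁ (trans (vertex-π (α + 1ℤ) β) (cong (λ x → π x β) (swap α (β /ℕ l * + h))))
    where
    swap : ∀ α z → (α + 1ℤ) + z ≡ (α + z) + 1ℤ
    swap = solve-∀
  edge-lift (edge-c α γ [γ]≢l∸1) = α + γ /ℕ l * + h , γ , vertex-π α γ ,
    inj₂ (trans (vertex-π α (γ + 1ℤ)) (cong (λ q → π (α + q * + h) (γ + 1ℤ)) (/ℕ-suc l γ γ%l≢l∸1)))
    where
    γ%l≢l∸1 : γ %ℕ l ≢ l ℕ.∸ 1
    γ%l≢l∸1 eq = [γ]≢l∸1 (trans (toℕ[]≡%ℕ γ) eq)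
  edge-lift (edge-h α) = α - + h , -1ℤ , wrap-source α , inj₂ (wrap-target α)

  π-translateʰ : ∀ i J i' J' x → π i J ≡ π i' J' → π (i + x) J ≡ π (i' + x) J'
  π-translateʰ i J i' J' x πiJ≡πi'J' = subst₂ (λ y y' → π (i + x) y ≡ π (i' + x) y')
    (ℤₚ.+-identityʳ J) (ℤₚ.+-identityʳ J') (π-translate i J i' J' x 0ℤ πiJ≡πi'J')

  π-translateᵛ : ∀ i J i' J' y → π i J ≡ π i' J' → π i (J + y) ≡ π i' (J' + y)
  π-translateᵛ i J i' J' y πiJ≡πi'J' = subst₂ (λ x x' → π x (J + y) ≡ π x' (J' + y))
    (ℤₚ.+-identityʳ i) (ℤₚ.+-identityʳ i') (π-translate i J i' J' 0ℤ y πiJ≡πi'J')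

  adjacentʰ : ∀ {e} → IsUnit e → ∀ i J → _~_ Γ (π i J) (π (i + e) J)
  adjacentʰ (inj₁ refl) i J = inj₁ (edgeʰ i J)
  adjacentʰ (inj₂ refl) i J =
    inj₂ (subst (λ x → ΓEdge m l h (π (i + -1ℤ) J) (π x J)) (pred-suc i) (edgeʰ (i + -1ℤ) J))
    where
    pred-suc : ∀ i → (i + -1ℤ) + 1ℤ ≡ i
    pred-suc = solve-∀

  adjacentᵛ : ∀ {e} → IsUnit e → ∀ i J → _~_ Γ (π i J) (π i (J + e))
  adjacentᵛ (inj₁ refl) i J = inj₁ (edgeᵛ i J)
  adjacentᵛ (inj₂ refl) i J =
    inj₂ (subst (λ y → ΓEdge m l h (π i (J + -1ℤ)) (π i y)) (pred-suc J) (edgeᵛ i (J + -1ℤ)))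
    where
    pred-suc : ∀ J → (J + -1ℤ) + 1ℤ ≡ J
    pred-suc = solve-∀

  private
    suc-pred : ∀ i → (i + 1ℤ) + -1ℤ ≡ i
    suc-pred = solve-∀

  neighbour : ∀ x y {w} → _~_ Γ (π x y) w → ∃[ e ] IsUnit e × (w ≡ π (x + e) y ⊎ w ≡ π x (y + e))
  neighbour x y (inj₁ πxy→w) with edge-lift πxy→w
  ... | i , J , πxy≡πiJ , inj₁ w≡πi+1J =
    1ℤ , inj₁ refl , inj₁ (trans w≡πi+1J (π-translateʰ i J x y 1ℤ (sym πxy≡πiJ)))
  ... | i , J , πxy≡πiJ , inj₂ w≡πiJ+1 =
    1ℤ , inj₁ refl , inj₂ (trans w≡πiJ+1 (π-translateᵛ i J x y 1ℤ (sym πxy≡πiJ)))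
  neighbour x y (inj₂ w→πxy) with edge-lift w→πxy
  ... | i , J , w≡πiJ , inj₁ πxy≡πi+1J =
    -1ℤ , inj₂ refl , inj₁ (trans w≡πiJ (trans (cong (λ i' → π i' J) (sym (suc-pred i)))
                                 (π-translateʰ (i + 1ℤ) J x y -1ℤ (sym πxy≡πi+1J))))
  ... | i , J , w≡πiJ , inj₂ πxy≡πiJ+1 =
    -1ℤ , inj₂ refl , inj₂ (trans w≡πiJ (trans (cong (π i) (sym (suc-pred J)))
                                 (π-translateᵛ i (J + 1ℤ) x y -1ℤ (sym πxy≡πiJ+1))))

-- 2-adic valuations

v₂-odd-part : ∀ f n → n ≢ 0 → n ℕ.≤ f → ∃[ o ] n ≡ 2 ℕ.^ v₂ f n ℕ.* o × ¬ 2 ∣ℕ o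
v₂-odd-part zero    zero    n≢0 _ = ⊥-elim (n≢0 refl)
v₂-odd-part (suc f) zero    n≢0 _ = ⊥-elim (n≢0 refl)
v₂-odd-part (suc f) (suc n) _ 1+n≤1+f with suc n ℕ.% 2 in 1+n%2 | ℕDM.m≡m%n+[m/n]*n (suc n) 2
... | zero        | 1+n≡H*2 = halve (suc n ℕ./ 2) 1+n≡H*2
  where
  halve : ∀ H → suc n ≡ H ℕ.* 2 → ∃[ o ] suc n ≡ 2 ℕ.^ suc (v₂ f H) ℕ.* o × ¬ 2 ∣ℕ o
  halve zero    ()
  halve (suc H) 1+n≡H*2 with v₂-odd-part f (suc H) ℕₚ.1+n≢0 1+H≤f
    where
    1+H≤f : suc H ℕ.≤ f
    1+H≤f = ℕₚ.≤-pred (ℕₚ.≤-trans (subst (suc H ℕ.<_) (sym 1+n≡H*2) (ℕₚ.m<m*n (suc H) 2 (ℕₚ.n<1+n 1)))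
                                  1+n≤1+f)
  ... | o , 1+H≡2^k*o , o-odd =
    o , trans 1+n≡H*2 (trans (cong (ℕ._* 2) 1+H≡2^k*o) (regroup (2 ℕ.^ v₂ f (suc H)) o)) , o-odd
    where
    regroup : ∀ p o → (p ℕ.* o) ℕ.* 2 ≡ (2 ℕ.* p) ℕ.* o
    regroup = ℕSolver.solve-∀
... | suc zero    | _ = suc n , sym (ℕₚ.*-identityˡ (suc n)) ,
                        λ 2∣1+n → ℕₚ.0≢1+n (trans (sym (ℕ∣.n∣m⇒m%n≡0 (suc n) 2 2∣1+n)) 1+n%2)
... | suc (suc _) | _ =
  ⊥-elim (ℕₚ.<⇒≱ (ℕDM.m%n<n (suc n) 2) (subst (2 ℕ.≤_) (sym 1+n%2) (ℕ.s≤s (ℕ.s≤s ℕ.z≤n))))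

σ-odd-part : ∀ x {k} → σ x ≡ fin k → ∃[ o ] ∣ x ∣ ≡ 2 ℕ.^ k ℕ.* o × ¬ 2 ∣ℕ o
σ-odd-part (+ suc n) refl = v₂-odd-part (suc n) (suc n) ℕₚ.1+n≢0 ℕₚ.≤-refl
σ-odd-part -[1+ n ]  refl = v₂-odd-part (suc n) (suc n) ℕₚ.1+n≢0 ℕₚ.≤-refl

v₂≢0⇒2∣ : ∀ f n → v₂ (suc f) (suc n) ≢ 0 → 2 ∣ℕ suc n
v₂≢0⇒2∣ f n v₂≢0 with suc n ℕ.% 2 in 1+n%2
... | zero  = ℕ∣.m%n≡0⇒n∣m (suc n) 2 1+n%2
... | suc _ = ⊥-elim (v₂≢0 refl)

σ≢0⇒2∣ : ∀ x → σ x ≢ fin 0 → 2 ∣ℕ ∣ x ∣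
σ≢0⇒2∣ (+ zero)  _   = 2 ℕ∣.∣0
σ≢0⇒2∣ (+ suc n) σ≢0 = v₂≢0⇒2∣ n n (λ v₂≡0 → σ≢0 (cong fin v₂≡0))
σ≢0⇒2∣ -[1+ n ]  σ≢0 = v₂≢0⇒2∣ n n (λ v₂≡0 → σ≢0 (cong fin v₂≡0))

2^s*2∣2^t : ∀ {s t} → s ℕ.< t → 2 ℕ.^ s ℕ.* 2 ∣ℕ 2 ℕ.^ t
2^s*2∣2^t {s} {t} s<t = ℕ∣.divides (2 ℕ.^ (t ℕ.∸ suc s)) (begin
  2 ℕ.^ t                                      ≡⟨ cong (2 ℕ.^_) (sym (ℕₚ.m+[n∸m]≡n s<t)) ⟩
  2 ℕ.^ (suc s ℕ.+ (t ℕ.∸ suc s))              ≡⟨ ℕₚ.^-distribˡ-+-* 2 (suc s) (t ℕ.∸ suc s) ⟩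
  2 ℕ.* 2 ℕ.^ s ℕ.* 2 ℕ.^ (t ℕ.∸ suc s)         ≡⟨ regroup (2 ℕ.^ s) (2 ℕ.^ (t ℕ.∸ suc s)) ⟩
  2 ℕ.^ (t ℕ.∸ suc s) ℕ.* (2 ℕ.^ s ℕ.* 2)       ∎)
  where
  open ≡-Reasoning
  regroup : ∀ p q → 2 ℕ.* p ℕ.* q ≡ q ℕ.* (p ℕ.* 2)
  regroup = ℕSolver.solve-∀

odd-part-<⇒2∣ : ∀ {a b w s t o o'} → a ≡ 2 ℕ.^ s ℕ.* o → ¬ 2 ∣ℕ o → b ≡ 2 ℕ.^ t ℕ.* o' →
                s ℕ.< t → b ∣ℕ w ℕ.* a → 2 ∣ℕ w
odd-part-<⇒2∣ {a} {b} {w} {s} {t} {o} {o'} a≡2^s*o o-odd b≡2^t*o' s<t b∣wa =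
  [ (λ 2∣w → 2∣w) , (λ 2∣o → ⊥-elim (o-odd 2∣o)) ]′ (euclidsLemma w o prime[2] 2∣w*o)
  where
  2^s*2∣b : 2 ℕ.^ s ℕ.* 2 ∣ℕ b
  2^s*2∣b = ℕ∣.∣-trans (2^s*2∣2^t s<t) (subst (_ ∣ℕ_) (sym b≡2^t*o') (ℕ∣.m∣m*n o'))
  regroup : ∀ w p o → w ℕ.* (p ℕ.* o) ≡ p ℕ.* (w ℕ.* o)
  regroup = ℕSolver.solve-∀
  wa≡2^s*[wo] : w ℕ.* a ≡ 2 ℕ.^ s ℕ.* (w ℕ.* o)
  wa≡2^s*[wo] = trans (cong (w ℕ.*_) a≡2^s*o) (regroup w (2 ℕ.^ s) o)
  2∣w*o : 2 ∣ℕ w ℕ.* o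
  2∣w*o = ℕ∣.*-cancelˡ-∣ (2 ℕ.^ s) {{ℕₚ.m^n≢0 2 s}}
            (ℕ∣.∣-trans 2^s*2∣b (subst (b ∣ℕ_) wa≡2^s*[wo] b∣wa))

σ<σ⇒2∣ : ∀ x m w .{{_ : NonZero m}} → σ x <∞ σ (+ m) → m ∣ℕ w ℕ.* ∣ x ∣ → 2 ∣ℕ w
σ<σ⇒2∣ x (suc m) w σx<σm m∣w∣x∣ with σ x in σx≡s | σx<σm
... | fin s | fin<fin s<t with σ-odd-part x σx≡s | σ-odd-part (+ suc m) refl
...   | _ , ∣x∣≡2^s*o , o-odd | _ , 1+m≡2^t*o' , _ =
  odd-part-<⇒2∣ ∣x∣≡2^s*o o-odd 1+m≡2^t*o' s<t m∣w∣x∣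

-- u·(m, 0) + v·(h, l) is parallel to the code lines, of direction (a, 1), iff m ∣ v·g;
-- it then translates a code line by v·l steps.
even-periods : ∀ {m l} .{{_ : NonZero m}} g → σ (+ l) ≢ fin 0 ⊎ σ g <∞ σ (+ m) →
               ∀ v → + m ∣ v * g → + 2 ∣ v * + l
even-periods {l = l} g (inj₁ σl≢0) v _ = ∣n⇒∣m*n v (∣ᵤ⇒∣ (σ≢0⇒2∣ (+ l) σl≢0))
even-periods {m} {l} g (inj₂ σg<σm) v m∣vg =
  ∣m⇒∣m*n (+ l) (∣ᵤ⇒∣ {i = v} (σ<σ⇒2∣ g m ∣ v ∣ σg<σm (subst (m ∣ℕ_) (ℤₚ.abs-* v g) (∣⇒∣ᵤ m∣vg))))

-- Levels and code lines

module Levels (m l h : ℕ) .{{_ : NonZero m}} .{{_ : NonZero l}} (a : ℤ) (a-unit : IsUnit a) where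
  open Covering m l h

  g : ℤ
  g = + l - a * + h

  level : ℤ → ℤ → ℤ
  level i J = i - a * J

  x+[a²-1]z≡x : ∀ x z → x + (a * a - 1ℤ) * z ≡ x
  x+[a²-1]z≡x x z = trans (cong (λ s → x + (s - 1ℤ) * z) (unit-square a-unit)) (vanish x z)
    where
    vanish : ∀ x z → x + (1ℤ - 1ℤ) * z ≡ x
    vanish = solve-∀

  level-line : ∀ R j → level (R + a * j) j ≡ R
  level-line R j = cancel R (a * j)
    where
    cancel : ∀ R z → (R + z) - z ≡ R
    cancel = solve-∀

  level-invariant : ∀ {d} → d ∣ + m → d ∣ g →
                    ∀ i J i' J' → π i J ≡ π i' J' → level i J ≡ level i' J' [mod d ]
  level-invariant {d} d∣m d∣g i J i' J' πiJ≡πi'J' with π-≡⁻ i J i' J' πiJ≡πi'J'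
  ... | v , J≡J'+vl , congruent m∣i-[i'+vh] = congruent (subst (d ∣_) (begin
    (i - (i' + v * + h)) - (a * v) * g                               ≡⟨ sym (x+[a²-1]z≡x _ (- (v * + h))) ⟩
    (i - (i' + v * + h)) - (a * v) * g + (a * a - 1ℤ) * - (v * + h) ≡⟨ expand i i' a v (+ l) (+ h) J' ⟩
    (i - a * (J' + v * + l)) - (i' - a * J')
      ≡⟨ cong (λ y → (i - a * y) - (i' - a * J')) (sym J≡J'+vl) ⟩
    level i J - level i' J'                                          ∎)
    (∣m∣n⇒∣m-n (∣-trans d∣m m∣i-[i'+vh]) (∣n⇒∣m*n (a * v) d∣g)))
    where
    open ≡-Reasoning
    expand : ∀ i i' a v l h J' → (i - (i' + v * h)) - (a * v) * (l - a * h) + (a * a - 1ℤ) * - (v * h)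
                                 ≡ (i - a * (J' + v * l)) - (i' - a * J')
    expand = solve-∀

  level-section : ∀ {d} → ∃₂ (λ U W → d ≡ U * + m + W * g) →
                  ∀ i J R → level i J ≡ R [mod d ] → ∃[ j ] π i J ≡ π (R + a * j) j
  level-section {d} (U , W , d≡Um+Wg) i J R level≡R with ≡[mod]⇒≡+* level≡R
  ... | k , level≡R+kd = J - v * + l , π-≡⁺ i J (R + a * j) j v (sym (cancel J (v * + l)))
                                         (≡+*⇒≡[mod] (k * U) i≡)
    where
    open ≡-Reasoning
    v = - (a * (k * W))
    j = J - v * + l
    cancel : ∀ J z → (J - z) + z ≡ J
    cancel = solve-∀
    regroup : ∀ R k U W m l h a J → (R + k * (U * m + W * (l - a * h))) + a * J + (a * a - 1ℤ) * (k * W * l)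
              ≡ ((R + a * (J - - (a * (k * W)) * l)) + - (a * (k * W)) * h) + (k * U) * m
    regroup = solve-∀
    i≡ : i ≡ ((R + a * j) + v * + h) + (k * U) * + m
    i≡ = begin
      i                                                                  ≡⟨ sym (cancel i (a * J)) ⟩
      level i J + a * J                                                  ≡⟨ cong (_+ a * J) level≡R+kd ⟩
      (R + k * d) + a * J                                                ≡⟨ cong (λ d → (R + k * d) + a * J) d≡Um+Wg ⟩
      (R + k * (U * + m + W * g)) + a * J                                ≡⟨ sym (x+[a²-1]z≡x _ (k * W * + l)) ⟩
      (R + k * (U * + m + W * g)) + a * J + (a * a - 1ℤ) * (k * W * + l) ≡⟨ regroup R k U W (+ m) (+ l) (+ h) a J ⟩
      ((R + a * j) + v * + h) + (k * U) * + m                            ∎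

  line-parity : (∀ v → + m ∣ v * g → + 2 ∣ v * + l) →
                ∀ R j j' → π (R + a * j) j ≡ π (R + a * j') j' → j ≡ j' [mod + 2 ]
  line-parity periods-even R j j' πj≡πj' with π-≡⁻ (R + a * j) j (R + a * j') j' πj≡πj'
  ... | v , j≡j'+vl , congruent m∣Δ = congruent (subst (+ 2 ∣_) j-j'≡vl
                                        (periods-even v (subst (+ m ∣_) a*Δ≡vg (∣n⇒∣m*n a m∣Δ))))
    where
    open ≡-Reasoning
    regroup : ∀ R a j' v l h → a * ((R + a * (j' + v * l)) - ((R + a * j') + v * h))
                                ≡ v * (l - a * h) + (a * a - 1ℤ) * (v * l)
    regroup = solve-∀
    a*Δ≡vg : a * ((R + a * j) - ((R + a * j') + v * + h)) ≡ v * g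
    a*Δ≡vg = begin
      a * ((R + a * j) - ((R + a * j') + v * + h))
        ≡⟨ cong (λ y → a * ((R + a * y) - ((R + a * j') + v * + h))) j≡j'+vl ⟩
      a * ((R + a * (j' + v * + l)) - ((R + a * j') + v * + h)) ≡⟨ regroup R a j' v (+ l) (+ h) ⟩
      v * g + (a * a - 1ℤ) * (v * + l)                         ≡⟨ x+[a²-1]z≡x (v * g) (v * + l) ⟩
      v * g                                                    ∎
    cancel : ∀ j' z → (j' + z) - j' ≡ z
    cancel = solve-∀
    j-j'≡vl : v * + l ≡ j - j'
    j-j'≡vl = sym (trans (cong (_- j') j≡j'+vl) (cancel j' (v * + l)))

  line-slide : ∀ i J R j k → π i J ≡ π (R + a * j) j → π (i + a * k) (J + k) ≡ π (R + a * (j + k)) (j + k)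
  line-slide i J R j k πiJ≡πRj = trans (π-translate i J (R + a * j) j (a * k) k πiJ≡πRj)
                                       (cong (λ x → π x (j + k)) (distrib R a j k))
    where
    distrib : ∀ R a j k → (R + a * j) + a * k ≡ R + a * (j + k)
    distrib = solve-∀

  unit-injective : ∀ {e e'} → - (a * e) ≡ - (a * e') → e ≡ e'
  unit-injective {e} {e'} -ae≡-ae' = begin
    e                  ≡⟨ sym (involution e) ⟩
    - a * - (a * e)    ≡⟨ cong (_*_ (- a)) -ae≡-ae' ⟩
    - a * - (a * e')   ≡⟨ involution e' ⟩
    e'                 ∎
    where
    open ≡-Reasoning
    regroup : ∀ a z → - a * - (a * z) ≡ z + (a * a - 1ℤ) * z
    regroup = solve-∀
    involution : ∀ z → - a * - (a * z) ≡ z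
    involution z = trans (regroup a z) (x+[a²-1]z≡x z z)

  module PerfectCode (B : ℕ) .{{_ : NonZero B}} (3B≡gcd : 3 ℕ.* B ≡ gcd ∣ g ∣ m)
    (periods-even : ∀ v → + m ∣ v * g → + 2 ∣ v * + l)
    (t : Fin B → Fin 2) where

    3B≡+gcd : + 3 * + B ≡ + gcd ∣ g ∣ m
    3B≡+gcd = trans (sym (ℤₚ.pos-* 3 B)) (cong +_ 3B≡gcd)

    3B∣m : + 3 * + B ∣ + m
    3B∣m = subst (_∣ + m) (sym 3B≡+gcd) (∣ᵤ⇒∣ (gcd[m,n]∣n ∣ g ∣ m))

    3B∣g : + 3 * + B ∣ g
    3B∣g = subst (_∣ g) (sym 3B≡+gcd) (∣ᵤ⇒∣ (gcd[m,n]∣m ∣ g ∣ m))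

    3B-bézout : ∃₂ λ U W → + 3 * + B ≡ U * + m + W * g
    3B-bézout = subst (λ d → ∃₂ λ U W → d ≡ U * + m + W * g) (sym 3B≡+gcd) (gcd-bézout g m)

    Γ□K₂ : Graph
    Γ□K₂ = ΓG m l h □ K₂

    InCode : V Γ□K₂ → Set
    InCode c = ∃ λ (r : Fin B) → Cᵃ m l h a (toℕ r) (t r) c

    offset : Fin B → ℤ
    offset r = + 3 * + toℕ r

    line-point : Fin B → ℤ → Fin m × Fin l
    line-point r j = π (offset r + a * j) j

    line-colour : Fin B → ℤ → Fin 2
    line-colour r j = [ j + + toℕ (t r) ] 2

    line-index-unique : ∀ (r r' : Fin B) j j' → line-point r j ≡ line-point r' j' → r ≡ r'
    line-index-unique r r' j j' πr≡πr' = begin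
      r                   ≡⟨ sym ([]-toℕ r) ⟩
      [ + toℕ r ] B       ≡⟨ []-cong (+ toℕ r) (+ toℕ r') (≡[mod]-cancel (+ 3) 3r≡3r') ⟩
      [ + toℕ r' ] B      ≡⟨ []-toℕ r' ⟩
      r'                  ∎
      where
      open ≡-Reasoning
      3r≡3r' : offset r ≡ offset r' [mod + 3 * + B ]
      3r≡3r' = subst₂ (λ x y → x ≡ y [mod + 3 * + B ]) (level-line (offset r) j) (level-line (offset r') j')
                 (level-invariant 3B∣m 3B∣g (offset r + a * j) j (offset r' + a * j') j' πr≡πr')

    code-functional : ∀ {u σ σ'} → InCode (u , σ) → InCode (u , σ') → σ ≡ σ'
    code-functional {u} {σ} {σ'} (r , j , u≡πr , σ≡) (r' , j' , u≡πr' , σ'≡) = begin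
      σ                  ≡⟨ σ≡ ⟩
      line-colour r j    ≡⟨ []-cong (j + T) (j' + T) (≡[mod]-+ʳ T j≡j') ⟩
      line-colour r j'   ≡⟨ cong (λ s → line-colour s j') r≡r' ⟩
      line-colour r' j'  ≡⟨ sym σ'≡ ⟩
      σ'                 ∎
      where
      open ≡-Reasoning
      T = + toℕ (t r)
      r≡r' : r ≡ r'
      r≡r' = line-index-unique r r' j j' (trans (sym u≡πr) u≡πr')
      j≡j' : j ≡ j' [mod + 2 ]
      j≡j' = line-parity periods-even (offset r) j j'
               (trans (sym u≡πr) (trans u≡πr' (cong (λ s → line-point s j') (sym r≡r'))))

    code-level : ∀ i J {σ} → InCode (π i J , σ) → level i J ≡ 0ℤ [mod + 3 ]
    code-level i J (r , j , πiJ≡πr , _) =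
      ≡[mod]-trans (≡[mod]-weaken (∣m⇒∣m*n (+ B) ∣-refl)
                     (subst (λ z → level i J ≡ z [mod + 3 * + B ]) (level-line (offset r) j)
                        (level-invariant 3B∣m 3B∣g i J (offset r + a * j) j πiJ≡πr)))
                   (≡+*⇒≡[mod] (+ toℕ r) (rearrange (+ toℕ r)))
      where
      rearrange : ∀ r → + 3 * r ≡ 0ℤ + r * + 3
      rearrange = solve-∀

    line-colour-flip : ∀ r j {k} → IsUnit k → line-colour r j ≢ line-colour r (j + k)
    line-colour-flip r j {k} k-unit eq =
      [x]₂≢[x+k]₂ k-unit (j + + toℕ (t r)) (trans eq (cong (λ z → [ z ] 2) (swap j k (+ toℕ (t r)))))
      where
      swap : ∀ j k T → (j + k) + T ≡ (j + T) + k
      swap = solve-∀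

    code-line-alternates : ∀ i J {σ k} → IsUnit k → InCode (π i J , σ) → ¬ InCode (π (i + a * k) (J + k) , σ)
    code-line-alternates i J {k = k} k-unit (r , j , πiJ≡πr , σ≡) slid-in-code =
      line-colour-flip r j k-unit (trans (sym σ≡)
        (code-functional slid-in-code (r , j + k , line-slide i J (offset r) j k πiJ≡πr , refl)))

    on-code-line : ∀ i J → level i J ≡ 0ℤ [mod + 3 ] → ∃₂ λ (r : Fin B) j → π i J ≡ line-point r j
    on-code-line i J level≡0 with ≡[mod]⇒≡+* level≡0
    ... | K , level≡0+K*3 = [ K ] B , level-section 3B-bézout i J (offset ([ K ] B))
          (≡[mod]-trans (≡⇒≡[mod] (trans level≡0+K*3 (rearrange K)))
                        (≡[mod]-scale (+ 3) (≡toℕ[] K)))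
      where
      rearrange : ∀ K → 0ℤ + K * + 3 ≡ + 3 * K
      rearrange = solve-∀

    Dominated : V Γ□K₂ → Set
    Dominated v = ∃[ c ] InCode c × dist≤1 Γ□K₂ v c

    dominated-on-line : ∀ x y σ → level x y ≡ 0ℤ [mod + 3 ] → Dominated (π x y , σ)
    dominated-on-line x y σ level≡0 = through (on-code-line x y level≡0)
      where
      through : (∃₂ λ r j → π x y ≡ line-point r j) → Dominated (π x y , σ)
      through (r , j , πxy≡πr) = by-colour (line-colour r j Fin.≟ σ)
        where
        by-colour : Dec (line-colour r j ≡ σ) → Dominated (π x y , σ)
        by-colour (yes colour≡σ) = (π x y , σ) , (r , j , πxy≡πr , sym colour≡σ) , inj₁ refl
        by-colour (no colour≢σ) = (π x y , line-colour r j) , (r , j , πxy≡πr , refl) ,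
                                  inj₂ (inj₂ (refl , λ σ≡colour → colour≢σ (sym σ≡colour)))

    dominated-by-twins : ∀ x y σ {ε} → IsUnit ε →
                         ∀ r j → π (x - ε) y ≡ line-point r j → Dominated (π x y , σ)
    dominated-by-twins x y σ {ε} ε-unit r j πx-εy≡πr =
      by-colour (Fin2-dichotomy (line-colour-flip r j aε-unit) σ)
      where
      aε-unit : IsUnit (a * ε)
      aε-unit = *-unit a-unit ε-unit
      regroup : ∀ x ε a → (x - ε) + a * (a * ε) ≡ x + (a * a - 1ℤ) * ε
      regroup = solve-∀
      πxy+aε≡πr : π x (y + a * ε) ≡ line-point r (j + a * ε)
      πxy+aε≡πr = trans (cong (λ x' → π x' (y + a * ε)) (sym (trans (regroup x ε a) (x+[a²-1]z≡x x ε))))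
                        (line-slide (x - ε) y (offset r) j (a * ε) πx-εy≡πr)
      by-colour : line-colour r j ≡ σ ⊎ line-colour r (j + a * ε) ≡ σ → Dominated (π x y , σ)
      by-colour (inj₁ colour≡σ) = (π (x - ε) y , line-colour r j) , (r , j , πx-εy≡πr , refl) ,
                                  inj₂ (inj₁ (adjacentʰ (-‿unit ε-unit) x y , sym colour≡σ))
      by-colour (inj₂ colour≡σ) = (π x (y + a * ε) , line-colour r (j + a * ε)) ,
                                  (r , j + a * ε , πxy+aε≡πr , refl) ,
                                  inj₂ (inj₁ (adjacentᵛ aε-unit x y , sym colour≡σ))

    dominated-off-line : ∀ x y σ {ε} → IsUnit ε → level x y ≡ ε [mod + 3 ] → Dominated (π x y , σ)
    dominated-off-line x y σ {ε} ε-unit level≡ε = through (on-code-line (x - ε) y level[x-ε]≡0)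
      where
      regroup : ∀ x y ε a → (x - a * y) - ε ≡ ((x - ε) - a * y) - 0ℤ
      regroup = solve-∀
      level[x-ε]≡0 : level (x - ε) y ≡ 0ℤ [mod + 3 ]
      level[x-ε]≡0 = congruent (subst (+ 3 ∣_) (regroup x y ε a) (divides-difference level≡ε))
      through : (∃₂ λ r j → π (x - ε) y ≡ line-point r j) → Dominated (π x y , σ)
      through (r , j , πx-εy≡πr) = dominated-by-twins x y σ ε-unit r j πx-εy≡πr

    dominated : ∀ x y σ → Dominated (π x y , σ)
    dominated x y σ = [ dominated-on-line x y σ ,
                        (λ (_ , ε-unit , level≡ε) → dominated-off-line x y σ ε-unit level≡ε) ]′
                      (mod3-cases (level x y))

    data Near (x y : ℤ) (σ : Fin 2) : V Γ□K₂ → Set where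
      here       : ∀ σ' → Near x y σ (π x y , σ')
      horizontal : ∀ {e} → IsUnit e → Near x y σ (π (x + e) y , σ)
      vertical   : ∀ {e} → IsUnit e → Near x y σ (π x (y + e) , σ)

    near : ∀ x y σ {c} → dist≤1 Γ□K₂ (π x y , σ) c → Near x y σ c
    near x y σ (inj₁ refl) = here σ
    near x y σ (inj₂ (inj₁ (πxy~w , refl))) = towards (neighbour x y πxy~w)
      where
      towards : ∀ {w} → ∃[ e ] IsUnit e × (w ≡ π (x + e) y ⊎ w ≡ π x (y + e)) → Near x y σ (w , σ)
      towards (_ , e-unit , inj₁ refl) = horizontal e-unit
      towards (_ , e-unit , inj₂ refl) = vertical e-unit
    near x y σ {_ , σ'} (inj₂ (inj₂ (refl , _))) = here σ'

    level-change : ∀ {x y σ c} → Near x y σ c → ℤ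
    level-change (here _)           = 0ℤ
    level-change (horizontal {e} _) = e
    level-change (vertical {e} _)   = - (a * e)

    near-level : ∀ {x y σ c} (n : Near x y σ c) → InCode c → level x y + level-change n ≡ 0ℤ [mod + 3 ]
    near-level {x} {y} (here _) c∈C =
      subst (λ z → z ≡ 0ℤ [mod + 3 ]) (sym (ℤₚ.+-identityʳ (level x y))) (code-level x y c∈C)
    near-level {x} {y} (horizontal {e} _) c∈C =
      subst (λ z → z ≡ 0ℤ [mod + 3 ]) (regroup x y e a) (code-level (x + e) y c∈C)
      where
      regroup : ∀ x y e a → (x + e) - a * y ≡ (x - a * y) + e
      regroup = solve-∀
    near-level {x} {y} (vertical {e} _) c∈C =
      subst (λ z → z ≡ 0ℤ [mod + 3 ]) (regroup x y e a) (code-level x (y + e) c∈C)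
      where
      regroup : ∀ x y e a → x - a * (y + e) ≡ (x - a * y) + - (a * e)
      regroup = solve-∀

    near-unique : ∀ {x y σ c c'} (n : Near x y σ c) (n' : Near x y σ c') → InCode c → InCode c' →
                  level-change n ≡ level-change n' [mod + 3 ] → c ≡ c'
    near-unique {x} {y} (here _) (here _) c∈C c'∈C _ = cong (_,_ (π x y)) (code-functional c∈C c'∈C)
    near-unique (here _) (horizontal e-unit) _ _ 0≡e =
      ⊥-elim (unit≢0[mod3] e-unit (≡[mod]-sym 0≡e))
    near-unique (here _) (vertical e-unit) _ _ 0≡-ae =
      ⊥-elim (unit≢0[mod3] (-‿unit (*-unit a-unit e-unit)) (≡[mod]-sym 0≡-ae))
    near-unique {x} {y} {σ} (horizontal e-unit) (horizontal e'-unit) _ _ e≡e' =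
      cong (λ e → π (x + e) y , σ) (units-≡[mod3] e-unit e'-unit e≡e')
    near-unique {x} {y} {σ} (vertical e-unit) (vertical e'-unit) _ _ -ae≡-ae' =
      cong (λ e → π x (y + e) , σ)
        (unit-injective (units-≡[mod3] (-‿unit (*-unit a-unit e-unit)) (-‿unit (*-unit a-unit e'-unit)) -ae≡-ae'))
    near-unique {x} {y} {σ} (horizontal {e} e-unit) (vertical {e'} e'-unit) c∈C c'∈C e≡-ae' =
      ⊥-elim (code-line-alternates x (y + e') (-‿unit e'-unit) c'∈C (subst (λ p → InCode (p , σ)) slide c∈C))
      where
      e≡ : e ≡ - (a * e')
      e≡ = units-≡[mod3] e-unit (-‿unit (*-unit a-unit e'-unit)) e≡-ae'
      regroup₁ : ∀ x a e' → x + - (a * e') ≡ x + a * - e'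
      regroup₁ = solve-∀
      regroup₂ : ∀ y e' → y ≡ (y + e') + - e'
      regroup₂ = solve-∀
      slide : π (x + e) y ≡ π (x + a * - e') ((y + e') + - e')
      slide = cong₂ π (trans (cong (_+_ x) e≡) (regroup₁ x a e')) (regroup₂ y e')
    near-unique n@(horizontal _) n'@(here _) c∈C c'∈C s≡s' = sym (near-unique n' n c'∈C c∈C (≡[mod]-sym s≡s'))
    near-unique n@(vertical _) n'@(here _) c∈C c'∈C s≡s' = sym (near-unique n' n c'∈C c∈C (≡[mod]-sym s≡s'))
    near-unique n@(vertical _) n'@(horizontal _) c∈C c'∈C s≡s' = sym (near-unique n' n c'∈C c∈C (≡[mod]-sym s≡s'))

    Unique : V Γ□K₂ → Set
    Unique v = ∀ c c' → InCode c → InCode c' → dist≤1 Γ□K₂ v c → dist≤1 Γ□K₂ v c' → c ≡ c'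

    unique : ∀ x y σ → Unique (π x y , σ)
    unique x y σ c c' c∈C c'∈C v~c v~c' = near-unique n n' c∈C c'∈C
      (≡[mod]-+-cancelˡ (level x y) (≡[mod]-trans (near-level n c∈C) (≡[mod]-sym (near-level n' c'∈C))))
      where
      n  = near x y σ v~c
      n' = near x y σ v~c'

    perfect : IsPerfectCode Γ□K₂ InCode
    perfect ((X , Y) , σ) = subst (λ u → Dominated (u , σ) × Unique (u , σ)) (π-toℕ X Y)
                              (dominated (+ toℕ X) (+ toℕ Y) σ , unique (+ toℕ X) (+ toℕ Y) σ)

proposition2p3 : (m l h : ℕ) → .{{_ : NonZero m}} → .{{_ : NonZero l}} →
    h < m → 6 ℕ∣.∣ m →
    (a : ℤ) → (a ≡ + 1 ⊎ a ≡ ℤ.- + 1) →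
    + 3 ℤ∣.∣ (+ l - a * + h) →
    ((¬ σ (+ h) ≡ fin 0 × ¬ σ (+ l) ≡ fin 0) ⊎ σ (+ l - a * + h) <∞ σ (+ m)) →
    (t : Fin (gcd ∣ + l - a * + h ∣ m / 3) → Fin 2) →
    IsPerfectCode (ΓG m l h □ K₂)
      (λ x → ∃ λ (r : Fin (gcd ∣ + l - a * + h ∣ m / 3)) → Cᵃ m l h a (toℕ r) (t r) x)
proposition2p3 m l h _ 6∣m a a-unit 3∣g hyp t =
  Levels.PerfectCode.perfect m l h a a-unit (d / 3) {{B-nonZero}} (ℕDM.m*[n/m]≡n 3∣d)
    (even-periods {m} {l} g (map₁ proj₂ hyp)) t
  where
  -- h < m and σ h ≢ fin 0 are not needed.
  g = + l - a * + h
  d = gcd ∣ g ∣ m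
  3∣d : 3 ∣ℕ d
  3∣d = gcd-greatest 3∣g (ℕ∣.∣-trans (ℕ∣.divides 2 refl) 6∣m)
  d-nonZero : NonZero d
  d-nonZero = ℕ.≢-nonZero (gcd[m,n]≢0 ∣ g ∣ m (inj₂ (ℕ.≢-nonZero⁻¹ m)))
  B-nonZero : NonZero (d / 3)
  B-nonZero = ℕ.>-nonZero (ℕDM.m≥n⇒m/n>0 (ℕ∣.∣⇒≤ {{d-nonZero}} 3∣d))
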